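{- Let $k \ge 2$ and $n \ge 3k-1$ be integers. Then the strong metric dimension of the Kneser graph $K_{n,k}$ is $\beta_S(K_{n,k}) = \binom{n}{k} - \lfloor n/k \rfloor$.
   Context: The Kneser graph $K_{n,k}$ has as vertices all $k$-element subsets of $[n]=\{1,\dots,n\}$, two being adjacent iff they are disjoint; $d$ denotes shortest-path distance. A vertex $w$ strongly resolves vertices $u,v$ if $d(v,w)=d(v,u)+d(u,w)$ or $d(u,w)=d(u,v)+d(v,w)$. A set $S$ of vertices is a strong resolving set if every pair of distinct vertices is strongly resolved by some vertex of $S$; $\beta_S(G)$ is the minimum cardinality of a strong resolving set of $G$. -}

module Defs where

open import Data.Nat using (ℕ; zero; suc; _+_; _≤_)
open import Data.Fin.Subset using (Subset; ∣_∣; _∩_; Empty)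
open import Data.Product using (Σ; _×_; ∃; ∃-syntax)
open import Data.Sum using (_⊎_)
open import Data.List using (List; length)
open import Data.List.Relation.Unary.All using (All)
open import Data.List.Relation.Unary.Any using (Any)
open import Data.List.Relation.Unary.Unique.Propositional using (Unique)
open import Relation.Binary.PropositionalEquality using (_≡_)
open import Relation.Nullary using (¬_)

IsVertex : (n k : ℕ) → Subset n → Set
IsVertex n k s = ∣ s ∣ ≡ k

Adjacent : {n : ℕ} → Subset n → Subset n → Set
Adjacent u v = Empty (u ∩ v)

data Walk (n k : ℕ) : Subset n → Subset n → ℕ → Set where
  here : ∀ {u} → Walk n k u u zero
  step : ∀ {u w v m} → IsVertex n k w → Adjacent u w →
         Walk n k w v m → Walk n k u v (suc m)

Dist : (n k : ℕ) → Subset n → Subset n → ℕ → Set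
Dist n k u v d = Walk n k u v d × (∀ m → Walk n k u v m → d ≤ m)

StronglyResolves : (n k : ℕ) → Subset n → Subset n → Subset n → Set
StronglyResolves n k w u v =
    (∃[ a ] ∃[ b ] ∃[ c ] (Dist n k v w a × Dist n k v u b × Dist n k u w c × a ≡ b + c))
  ⊎ (∃[ a ] ∃[ b ] ∃[ c ] (Dist n k u w a × Dist n k u v b × Dist n k v w c × a ≡ b + c))

IsStrongResolvingSet : (n k : ℕ) → List (Subset n) → Set
IsStrongResolvingSet n k S =
  Unique S × All (IsVertex n k) S ×
  (∀ u v → IsVertex n k u → IsVertex n k v → ¬ (u ≡ v) →
     Any (λ w → StronglyResolves n k w u v) S)

StrongMetricDim : (n k m : ℕ) → Set
StrongMetricDim n k m =
  (Σ (List (Subset n)) λ S → IsStrongResolvingSet n k S × length S ≡ m)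
  × (∀ S → IsStrongResolvingSet n k S → m ≤ length S)

{-# OPTIONS --safe #-}
-- For n ≥ 3k - 1 two distinct k-sets are at distance 1 when disjoint and 2 otherwise,
-- since the complement of the union of two meeting k-sets still has k points; so
-- K(n,k) has diameter 2. In a graph of diameter 2 a vertex strongly resolves two
-- vertices at distance 2 only if it is one of them. Hence the vertices outside a
-- strong resolving set are pairwise disjoint k-sets, of which there are at most
-- ⌊n/k⌋. Conversely, the complement of ⌊n/k⌋ pairwise disjoint k-sets resolves
-- every pair: a pair with a member outside the family is resolved by that member,
-- and two disjoint members u, v are resolved by a k-set disjoint from u that meets v
-- without being v; such a set exists for k ≥ 2 and lies outside the family.
module Submission where

open import Defs
open import Data.Nat using (ℕ; zero; suc; _+_; _*_; _∸_; _≤_; _<_; z≤n; s≤s; s≤s⁻¹; NonZero)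
open import Data.Nat.Properties
open import Data.Nat.DivMod using (_/_; m*n/n≡m; m/n*n≤m; /-monoˡ-≤)
open import Data.Nat.Combinatorics using (_C_; nCk+nC[k+1]≡[n+1]C[k+1])
open import Data.Bool using (true; false; _∧_)
import Data.Bool as Bool
open import Data.Vec using ([]; _∷_; _++_)
open import Data.Vec.Properties using (≡-dec; zipWith-++; ++-injectiveʳ; ∷-injectiveʳ)
open import Data.Fin.Subset
open import Data.Fin.Subset.Properties
open import Data.Product using (Σ; _×_; _,_; ∃; proj₁; proj₂)
open import Data.Sum using (_⊎_; inj₁; inj₂; [_,_]; swap)
open import Data.Empty using (⊥-elim)
open import Function using (_∘_)
open import Data.List using (List; []; _∷_; length; map; filter) renaming (_++_ to _++ₗ_)
open import Data.List.Properties using (length-++; length-map; filter-notAll)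
open import Data.List.Membership.Propositional using (find; lose) renaming (_∈_ to _∈ₗ_; _∉_ to _∉ₗ_)
open import Data.List.Membership.Propositional.Properties using (∈-map⁺; ∈-map⁻; ∈-++⁺ˡ; ∈-++⁺ʳ; ∈-++⁻; ∈-filter⁺; ∈-filter⁻)
open import Data.List.Relation.Binary.Subset.Propositional using () renaming (_⊆_ to _⊆ₗ_)
open import Data.List.Relation.Unary.All as All using (All; []; _∷_)
open import Data.List.Relation.Unary.All.Properties using (all-filter) renaming (map⁺ to All-map⁺; filter⁺ to All-filter⁺)
open import Data.List.Relation.Unary.Any using (Any; here; there)
open import Data.List.Relation.Unary.AllPairs using ([]; _∷_)
open import Data.List.Relation.Unary.Unique.Propositional using (Unique)
import Data.List.Relation.Unary.Unique.Propositional.Properties as Unique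
open import Data.List.Relation.Ternary.Interleaving.Propositional.Properties using (interleave-length) renaming (filter⁺ to interleave-filter)
import Data.List.Membership.DecPropositional as DecMembership
open import Relation.Binary.Definitions using (DecidableEquality)
open import Relation.Binary.PropositionalEquality using (_≡_; _≢_; refl; sym; trans; cong; cong₂; subst; module ≡-Reasoning)
open import Relation.Nullary using (¬_; yes; no; ¬?; contradiction)

-- Subsets of Fin n

_≟ˢ_ : ∀ {n} → DecidableEquality (Subset n)
_≟ˢ_ = ≡-dec Bool._≟_

Empty-∩⁺ : ∀ {n} {p q : Subset n} → (∀ {i} → i ∈ p → i ∉ q) → Empty (p ∩ q)
Empty-∩⁺ {p = p} {q} disjoint (i , i∈p∩q) = let (i∈p , i∈q) = x∈p∩q⁻ p q i∈p∩q in disjoint i∈p i∈q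

Empty-∩⁻ : ∀ {n} {p q : Subset n} {i} → Empty (p ∩ q) → i ∈ p → i ∉ q
Empty-∩⁻ p∩q=∅ i∈p i∈q = p∩q=∅ (_ , x∈p∩q⁺ (i∈p , i∈q))

Empty-∩-sym : ∀ {n} {p q : Subset n} → Empty (p ∩ q) → Empty (q ∩ p)
Empty-∩-sym p∩q=∅ = Empty-∩⁺ λ i∈q i∈p → Empty-∩⁻ p∩q=∅ i∈p i∈q

Empty-⊥∩ : ∀ {n} (p : Subset n) → Empty (⊥ ∩ p)
Empty-⊥∩ p = Empty-∩⁺ λ i∈⊥ _ → ∉⊥ i∈⊥

Empty-∩⊥ : ∀ {n} (p : Subset n) → Empty (p ∩ ⊥)
Empty-∩⊥ p = Empty-∩⁺ λ _ → ∉⊥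

Empty⇒∣p∣≡0 : ∀ {n} {p : Subset n} → Empty p → ∣ p ∣ ≡ 0
Empty⇒∣p∣≡0 {n} p=∅ = trans (cong ∣_∣ (Empty-unique p=∅)) (∣⊥∣≡0 n)

x∈p⇒⁅x⁆⊆p : ∀ {n} {p : Subset n} {x} → x ∈ p → ⁅ x ⁆ ⊆ p
x∈p⇒⁅x⁆⊆p {p = p} {x} x∈p y∈⁅x⁆ = subst (_∈ p) (sym (x∈⁅y⁆⇒x≡y x y∈⁅x⁆)) x∈p

Nonempty⇒0<∣p∣ : ∀ {n} {p : Subset n} → Nonempty p → 0 < ∣ p ∣
Nonempty⇒0<∣p∣ {p = p} (x , x∈p) = begin
  1           ≡⟨ ∣⁅x⁆∣≡1 x ⟨
  ∣ ⁅ x ⁆ ∣   ≤⟨ p⊆q⇒∣p∣≤∣q∣ (x∈p⇒⁅x⁆⊆p x∈p) ⟩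
  ∣ p ∣       ∎
  where open ≤-Reasoning

∣p∣≡1+m⇒Nonempty : ∀ {n m} {p : Subset n} → ∣ p ∣ ≡ suc m → Nonempty p
∣p∣≡1+m⇒Nonempty {p = p} ∣p∣≡1+m with nonempty? p
... | yes p≠∅ = p≠∅
... | no p=∅ = contradiction (trans (sym (Empty⇒∣p∣≡0 p=∅)) ∣p∣≡1+m) 0≢1+n

∣p∪q∣+∣p∩q∣≡∣p∣+∣q∣ : ∀ {n} (p q : Subset n) → ∣ p ∪ q ∣ + ∣ p ∩ q ∣ ≡ ∣ p ∣ + ∣ q ∣
∣p∪q∣+∣p∩q∣≡∣p∣+∣q∣ [] [] = refl
∣p∪q∣+∣p∩q∣≡∣p∣+∣q∣ (true ∷ p) (true ∷ q) = cong suc (begin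
  ∣ p ∪ q ∣ + suc ∣ p ∩ q ∣   ≡⟨ +-suc ∣ p ∪ q ∣ ∣ p ∩ q ∣ ⟩
  suc (∣ p ∪ q ∣ + ∣ p ∩ q ∣) ≡⟨ cong suc (∣p∪q∣+∣p∩q∣≡∣p∣+∣q∣ p q) ⟩
  suc (∣ p ∣ + ∣ q ∣)         ≡⟨ +-suc ∣ p ∣ ∣ q ∣ ⟨
  ∣ p ∣ + suc ∣ q ∣           ∎)
  where open ≡-Reasoning
∣p∪q∣+∣p∩q∣≡∣p∣+∣q∣ (true ∷ p) (false ∷ q) = cong suc (∣p∪q∣+∣p∩q∣≡∣p∣+∣q∣ p q)
∣p∪q∣+∣p∩q∣≡∣p∣+∣q∣ (false ∷ p) (true ∷ q) =
  trans (cong suc (∣p∪q∣+∣p∩q∣≡∣p∣+∣q∣ p q)) (sym (+-suc ∣ p ∣ ∣ q ∣))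
∣p∪q∣+∣p∩q∣≡∣p∣+∣q∣ (false ∷ p) (false ∷ q) = ∣p∪q∣+∣p∩q∣≡∣p∣+∣q∣ p q

Empty-∩⇒∣p∪q∣≡∣p∣+∣q∣ : ∀ {n} {p q : Subset n} → Empty (p ∩ q) → ∣ p ∪ q ∣ ≡ ∣ p ∣ + ∣ q ∣
Empty-∩⇒∣p∪q∣≡∣p∣+∣q∣ {p = p} {q} p∩q=∅ = begin
  ∣ p ∪ q ∣                 ≡⟨ +-identityʳ ∣ p ∪ q ∣ ⟨
  ∣ p ∪ q ∣ + 0             ≡⟨ cong (∣ p ∪ q ∣ +_) (Empty⇒∣p∣≡0 p∩q=∅) ⟨
  ∣ p ∪ q ∣ + ∣ p ∩ q ∣     ≡⟨ ∣p∪q∣+∣p∩q∣≡∣p∣+∣q∣ p q ⟩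
  ∣ p ∣ + ∣ q ∣             ∎
  where open ≡-Reasoning

∣p++q∣≡∣p∣+∣q∣ : ∀ {a b} (p : Subset a) (q : Subset b) → ∣ p ++ q ∣ ≡ ∣ p ∣ + ∣ q ∣
∣p++q∣≡∣p∣+∣q∣ [] q = refl
∣p++q∣≡∣p∣+∣q∣ (true ∷ p) q = cong suc (∣p++q∣≡∣p∣+∣q∣ p q)
∣p++q∣≡∣p∣+∣q∣ (false ∷ p) q = ∣p++q∣≡∣p∣+∣q∣ p q

⊥++⊥ : ∀ a {b} → ⊥ {a} ++ ⊥ {b} ≡ ⊥
⊥++⊥ zero = refl
⊥++⊥ (suc a) = cong (false ∷_) (⊥++⊥ a)

Empty-∩-++ : ∀ {a b} {p r : Subset a} {q s : Subset b} →
             Empty (p ∩ r) → Empty (q ∩ s) → Empty ((p ++ q) ∩ (r ++ s))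
Empty-∩-++ {a} {b} {p = p} {r} {q} {s} p∩r=∅ q∩s=∅ (i , i∈) = ∉⊥ (subst (i ∈_) ≡⊥ i∈)
  where
  open ≡-Reasoning
  ≡⊥ : (p ++ q) ∩ (r ++ s) ≡ ⊥
  ≡⊥ = begin
    (p ++ q) ∩ (r ++ s)  ≡⟨ zipWith-++ _∧_ p q r s ⟩
    (p ∩ r) ++ (q ∩ s)   ≡⟨ cong₂ _++_ (Empty-unique p∩r=∅) (Empty-unique q∩s=∅) ⟩
    ⊥ {a} ++ ⊥ {b}       ≡⟨ ⊥++⊥ a ⟩
    ⊥                    ∎

∃-⊆-ofSize : ∀ {n} m (s : Subset n) → m ≤ ∣ s ∣ → ∃ λ t → t ⊆ s × ∣ t ∣ ≡ m
∃-⊆-ofSize {n} zero s _ = ⊥ , ⊥⊆ , ∣⊥∣≡0 n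
∃-⊆-ofSize (suc m) (true ∷ s) (s≤s m≤∣s∣) =
  let (t , t⊆s , ∣t∣≡m) = ∃-⊆-ofSize m s m≤∣s∣ in true ∷ t , in⊆in t⊆s , cong suc ∣t∣≡m
∃-⊆-ofSize (suc m) (false ∷ s) m<∣s∣ =
  let (t , t⊆s , ∣t∣≡m) = ∃-⊆-ofSize (suc m) s m<∣s∣ in false ∷ t , out⊆ t⊆s , ∣t∣≡m

∃-avoiding-ofSize : ∀ {n} m (p : Subset n) → m + ∣ p ∣ ≤ n →
                    ∃ λ t → ∣ t ∣ ≡ m × Empty (t ∩ p)
∃-avoiding-ofSize m p m+∣p∣≤n =
  let (t , t⊆∁p , ∣t∣≡m) = ∃-⊆-ofSize m (∁ p) m≤∣∁p∣
  in t , ∣t∣≡m , Empty-∩⁺ λ i∈t → x∈∁p⇒x∉p (t⊆∁p i∈t)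
  where
  m≤∣∁p∣ : m ≤ ∣ ∁ p ∣
  m≤∣∁p∣ = subst (m ≤_) (sym (∣∁p∣≡n∸∣p∣ p)) (m+n≤o⇒m≤o∸n m m+∣p∣≤n)

x∈⋃⁻ : ∀ {n} (T : List (Subset n)) {i} → i ∈ ⋃ T → ∃ λ p → p ∈ₗ T × i ∈ p
x∈⋃⁻ [] i∈⊥ = ⊥-elim (∉⊥ i∈⊥)
x∈⋃⁻ (p ∷ T) i∈p∪⋃T with x∈p∪q⁻ p (⋃ T) i∈p∪⋃T
... | inj₁ i∈p = p , here refl , i∈p
... | inj₂ i∈⋃T = let (q , q∈T , i∈q) = x∈⋃⁻ T i∈⋃T in q , there q∈T , i∈q

-- Enumerating the k-subsets of Fin n

subsetsOfSize : (n k : ℕ) → List (Subset n)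
subsetsOfSize zero zero = [] ∷ []
subsetsOfSize zero (suc k) = []
subsetsOfSize (suc n) zero = map (false ∷_) (subsetsOfSize n zero)
subsetsOfSize (suc n) (suc k) =
  map (true ∷_) (subsetsOfSize n k) ++ₗ map (false ∷_) (subsetsOfSize n (suc k))

length-subsetsOfSize : ∀ n k → length (subsetsOfSize n k) ≡ n C k
length-subsetsOfSize zero zero = refl
length-subsetsOfSize zero (suc k) = refl
length-subsetsOfSize (suc n) zero =
  trans (length-map (false ∷_) (subsetsOfSize n zero)) (length-subsetsOfSize n zero)
length-subsetsOfSize (suc n) (suc k) = begin
  length (map (true ∷_) (subsetsOfSize n k) ++ₗ map (false ∷_) (subsetsOfSize n (suc k)))
    ≡⟨ length-++ (map (true ∷_) (subsetsOfSize n k)) ⟩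
  length (map (true ∷_) (subsetsOfSize n k)) + length (map (false ∷_) (subsetsOfSize n (suc k)))
    ≡⟨ cong₂ _+_ (length-map (true ∷_) (subsetsOfSize n k)) (length-map (false ∷_) (subsetsOfSize n (suc k))) ⟩
  length (subsetsOfSize n k) + length (subsetsOfSize n (suc k))
    ≡⟨ cong₂ _+_ (length-subsetsOfSize n k) (length-subsetsOfSize n (suc k)) ⟩
  n C k + n C suc k
    ≡⟨ nCk+nC[k+1]≡[n+1]C[k+1] n k ⟩
  suc n C suc k ∎
  where open ≡-Reasoning

∈-subsetsOfSize⁻ : ∀ n k {s} → s ∈ₗ subsetsOfSize n k → ∣ s ∣ ≡ k
∈-subsetsOfSize⁻ zero zero (here refl) = refl
∈-subsetsOfSize⁻ (suc n) zero s∈ with ∈-map⁻ (false ∷_) s∈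
... | t , t∈ , refl = ∈-subsetsOfSize⁻ n zero t∈
∈-subsetsOfSize⁻ (suc n) (suc k) s∈ with ∈-++⁻ (map (true ∷_) (subsetsOfSize n k)) s∈
... | inj₁ s∈₁ with ∈-map⁻ (true ∷_) s∈₁
...   | t , t∈ , refl = cong suc (∈-subsetsOfSize⁻ n k t∈)
∈-subsetsOfSize⁻ (suc n) (suc k) s∈ | inj₂ s∈₂ with ∈-map⁻ (false ∷_) s∈₂
...   | t , t∈ , refl = ∈-subsetsOfSize⁻ n (suc k) t∈

∈-subsetsOfSize⁺ : ∀ {n k} (s : Subset n) → ∣ s ∣ ≡ k → s ∈ₗ subsetsOfSize n k
∈-subsetsOfSize⁺ {zero} {zero} [] _ = here refl
∈-subsetsOfSize⁺ {suc n} {zero} (false ∷ s) ∣s∣≡0 = ∈-map⁺ (false ∷_) (∈-subsetsOfSize⁺ s ∣s∣≡0)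
∈-subsetsOfSize⁺ {suc n} {suc k} (true ∷ s) ∣s∣≡k =
  ∈-++⁺ˡ (∈-map⁺ (true ∷_) (∈-subsetsOfSize⁺ s (suc-injective ∣s∣≡k)))
∈-subsetsOfSize⁺ {suc n} {suc k} (false ∷ s) ∣s∣≡k =
  ∈-++⁺ʳ (map (true ∷_) (subsetsOfSize n k)) (∈-map⁺ (false ∷_) (∈-subsetsOfSize⁺ s ∣s∣≡k))

subsetsOfSize-unique : ∀ n k → Unique (subsetsOfSize n k)
subsetsOfSize-unique zero zero = [] ∷ []
subsetsOfSize-unique zero (suc k) = []
subsetsOfSize-unique (suc n) zero = Unique.map⁺ ∷-injectiveʳ (subsetsOfSize-unique n zero)
subsetsOfSize-unique (suc n) (suc k) =
  Unique.++⁺ (Unique.map⁺ ∷-injectiveʳ (subsetsOfSize-unique n k))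
             (Unique.map⁺ ∷-injectiveʳ (subsetsOfSize-unique n (suc k)))
             heads-differ
  where
  heads-differ : ∀ {s} → ¬ (s ∈ₗ map (true ∷_) (subsetsOfSize n k) × s ∈ₗ map (false ∷_) (subsetsOfSize n (suc k)))
  heads-differ (s∈₁ , s∈₂) with ∈-map⁻ (true ∷_) s∈₁ | ∈-map⁻ (false ∷_) s∈₂
  ... | _ , _ , refl | _ , _ , ()

All-subsetsOfSize : ∀ n k → All (IsVertex n k) (subsetsOfSize n k)
All-subsetsOfSize n k = All.tabulate (∈-subsetsOfSize⁻ n k)

All-IsVertex⇒⊆subsetsOfSize : ∀ {n k T} → All (IsVertex n k) T → T ⊆ₗ subsetsOfSize n k
All-IsVertex⇒⊆subsetsOfSize T-vertices u∈T = ∈-subsetsOfSize⁺ _ (All.lookup T-vertices u∈T)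

-- Counting duplicate-free lists

module _ {a} {A : Set a} (_≟_ : DecidableEquality A) where
  open DecMembership _≟_ using () renaming (_∈?_ to _∈ₗ?_; _∉?_ to _∉ₗ?_)

  Unique⇒length≤ : ∀ {xs ys : List A} → Unique xs → xs ⊆ₗ ys → length xs ≤ length ys
  Unique⇒length≤ {[]} _ _ = z≤n
  Unique⇒length≤ {x ∷ xs} {ys} (x∉xs ∷ xs-unique) x∷xs⊆ys = begin
    suc (length xs)                            ≤⟨ s≤s (Unique⇒length≤ xs-unique xs⊆ys-x) ⟩
    suc (length (filter (¬? ∘ (x ≟_)) ys))   ≤⟨ filter-notAll (¬? ∘ (x ≟_)) ys (lose (x∷xs⊆ys (here refl)) λ x≢x → x≢x refl) ⟩
    length ys                                  ∎
    where
    open ≤-Reasoning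
    xs⊆ys-x : xs ⊆ₗ filter (¬? ∘ (x ≟_)) ys
    xs⊆ys-x z∈xs = ∈-filter⁺ (¬? ∘ (x ≟_)) (x∷xs⊆ys (there z∈xs)) (All.lookup x∉xs z∈xs)

  length-filter-∈ : ∀ {xs ys} → Unique xs → Unique ys → xs ⊆ₗ ys → length (filter (_∈ₗ? xs) ys) ≡ length xs
  length-filter-∈ {xs} {ys} xs-unique ys-unique xs⊆ys = ≤-antisym
    (Unique⇒length≤ (Unique.filter⁺ (_∈ₗ? xs) ys-unique) (λ z∈ → proj₂ (∈-filter⁻ (_∈ₗ? xs) {xs = ys} z∈)))
    (Unique⇒length≤ xs-unique (λ z∈xs → ∈-filter⁺ (_∈ₗ? xs) (xs⊆ys z∈xs) z∈xs))

  length≡length+length-filter-∉ : ∀ {xs ys} → Unique xs → Unique ys → xs ⊆ₗ ys →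
                                   length ys ≡ length xs + length (filter (_∉ₗ? xs) ys)
  length≡length+length-filter-∉ {xs} {ys} xs-unique ys-unique xs⊆ys =
    trans (interleave-length {A = A} {B = A} (interleave-filter (_∈ₗ? xs) ys))
          (cong (_+ length (filter (_∉ₗ? xs) ys)) (length-filter-∈ xs-unique ys-unique xs⊆ys))

-- Cliques of the Kneser graph

IsClique : ∀ {n} → List (Subset n) → Set
IsClique T = ∀ {u v} → u ∈ₗ T → v ∈ₗ T → u ≢ v → Adjacent u v

IsClique-∷ : ∀ {n} {u : Subset n} {T} → All (Adjacent u) T → IsClique T → IsClique (u ∷ T)
IsClique-∷ _ _ (here refl) (here refl) u≢u = ⊥-elim (u≢u refl)
IsClique-∷ u~T _ (here refl) (there v∈T) _ = All.lookup u~T v∈T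
IsClique-∷ u~T _ (there u∈T) (here refl) _ = Empty-∩-sym (All.lookup u~T u∈T)
IsClique-∷ _ T-clique (there u∈T) (there v∈T) u≢v = T-clique u∈T v∈T u≢v

IsClique-map : ∀ {m n} {f : Subset m → Subset n} {T} →
               (∀ {s t} → Adjacent s t → Adjacent (f s) (f t)) → IsClique T → IsClique (map f T)
IsClique-map {f = f} f-adjacent T-clique fs∈ ft∈ fs≢ft with ∈-map⁻ f fs∈ | ∈-map⁻ f ft∈
... | s , s∈T , refl | t , t∈T , refl = f-adjacent (T-clique s∈T t∈T λ s≡t → fs≢ft (cong f s≡t))

∣⋃clique∣≡length*k : ∀ {n k} {T : List (Subset n)} → Unique T → All (IsVertex n k) T → IsClique T →
                     ∣ ⋃ T ∣ ≡ length T * k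
∣⋃clique∣≡length*k {n} {T = []} _ _ _ = ∣⊥∣≡0 n
∣⋃clique∣≡length*k {k = k} {u ∷ T} (u∉T ∷ T-unique) (∣u∣≡k ∷ T-vertices) u∷T-clique = begin
  ∣ u ∪ ⋃ T ∣       ≡⟨ Empty-∩⇒∣p∪q∣≡∣p∣+∣q∣ u∩⋃T=∅ ⟩
  ∣ u ∣ + ∣ ⋃ T ∣   ≡⟨ cong₂ _+_ ∣u∣≡k (∣⋃clique∣≡length*k T-unique T-vertices T-clique) ⟩
  k + length T * k  ∎
  where
  open ≡-Reasoning
  T-clique : IsClique T
  T-clique u∈T v∈T = u∷T-clique (there u∈T) (there v∈T)
  u∩⋃T=∅ : Empty (u ∩ ⋃ T)
  u∩⋃T=∅ = Empty-∩⁺ λ i∈u i∈⋃T →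
    let (v , v∈T , i∈v) = x∈⋃⁻ T i∈⋃T
    in Empty-∩⁻ (u∷T-clique (here refl) (there v∈T) (All.lookup u∉T v∈T)) i∈u i∈v

clique-length≤n/k : ∀ {n k} .{{_ : NonZero k}} {T : List (Subset n)} →
                    Unique T → All (IsVertex n k) T → IsClique T → length T ≤ n / k
clique-length≤n/k {n} {k} {T} T-unique T-vertices T-clique = begin
  length T          ≡⟨ m*n/n≡m (length T) k ⟨
  length T * k / k  ≡⟨ cong (_/ k) (∣⋃clique∣≡length*k T-unique T-vertices T-clique) ⟨
  ∣ ⋃ T ∣ / k       ≤⟨ /-monoˡ-≤ k (∣p∣≤n (⋃ T)) ⟩
  n / k             ∎
  where open ≤-Reasoning

CliqueOfSize : (n k q : ℕ) → Set
CliqueOfSize n k q = Σ (List (Subset n)) λ T →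
  length T ≡ q × Unique T × All (IsVertex n k) T × IsClique T

extendClique : ∀ {k m q} → CliqueOfSize m (suc k) q → CliqueOfSize (suc k + m) (suc k) (suc q)
extendClique {k} {m} (T , ∣T∣≡q , T-unique , T-vertices , T-clique) =
  block ∷ map pad T ,
  cong suc (trans (length-map pad T) ∣T∣≡q) ,
  All-map⁺ (All.tabulate λ {s} _ → block≢pad s) ∷ Unique.map⁺ (++-injectiveʳ (⊥ {suc k}) ⊥) T-unique ,
  ∣block∣≡k ∷ All-map⁺ (All.map ∣pad∣≡ T-vertices) ,
  IsClique-∷ (All-map⁺ (All.tabulate λ {s} _ → block-adjacent-pad s)) (IsClique-map pad-adjacent T-clique)
  where
  block : Subset (suc k + m)
  block = ⊤ {suc k} ++ ⊥ {m}
  pad : Subset m → Subset (suc k + m)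
  pad s = ⊥ {suc k} ++ s
  ∣block∣≡k : ∣ block ∣ ≡ suc k
  ∣block∣≡k = trans (∣p++q∣≡∣p∣+∣q∣ (⊤ {suc k}) (⊥ {m}))
                    (trans (cong₂ _+_ (∣⊤∣≡n (suc k)) (∣⊥∣≡0 m)) (+-identityʳ (suc k)))
  block≢pad : ∀ s → block ≢ pad s
  block≢pad s ()
  block-adjacent-pad : ∀ s → Adjacent block (pad s)
  block-adjacent-pad s = Empty-∩-++ {p = ⊤} {⊥} {⊥} {s} (Empty-∩⊥ ⊤) (Empty-⊥∩ s)
  pad-adjacent : ∀ {s t} → Adjacent s t → Adjacent (pad s) (pad t)
  pad-adjacent {s} {t} = Empty-∩-++ {p = ⊥} {⊥} {s} {t} (Empty-⊥∩ ⊥)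
  ∣pad∣≡ : ∀ {s} → ∣ s ∣ ≡ suc k → ∣ pad s ∣ ≡ suc k
  ∣pad∣≡ {s} ∣s∣≡k = trans (∣p++q∣≡∣p∣+∣q∣ (⊥ {suc k}) s) (cong₂ _+_ (∣⊥∣≡0 (suc k)) ∣s∣≡k)

∃-clique : ∀ {k} q m → CliqueOfSize (q * suc k + m) (suc k) q
∃-clique zero m = [] , refl , [] , [] , λ ()
∃-clique {k} (suc q) m = subst (λ n → CliqueOfSize n (suc k) (suc q))
  (sym (+-assoc (suc k) (q * suc k) m)) (extendClique (∃-clique q m))

∃-clique-≤ : ∀ {k n} q → q * suc k ≤ n → CliqueOfSize n (suc k) q
∃-clique-≤ {k} {n} q q*k≤n =
  subst (λ n → CliqueOfSize n (suc k) q) (m+[n∸m]≡n q*k≤n) (∃-clique q (n ∸ q * suc k))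

-- Distances in the Kneser graph

Walk-0⇒≡ : ∀ {n k} {u v : Subset n} → Walk n k u v 0 → u ≡ v
Walk-0⇒≡ here = refl

Walk-1⇒Adjacent : ∀ {n k} {u v : Subset n} → Walk n k u v 1 → Adjacent u v
Walk-1⇒Adjacent (step _ u~v here) = u~v

Walk-length≥2 : ∀ {n k} {u v : Subset n} {m} → u ≢ v → ¬ Adjacent u v → Walk n k u v m → 2 ≤ m
Walk-length≥2 {m = zero} u≢v _ walk = contradiction (Walk-0⇒≡ walk) u≢v
Walk-length≥2 {m = suc zero} _ ¬u~v walk = contradiction (Walk-1⇒Adjacent walk) ¬u~v
Walk-length≥2 {m = suc (suc m)} _ _ _ = s≤s (s≤s z≤n)

Dist-refl : ∀ {n k} {u : Subset n} → Dist n k u u 0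
Dist-refl = here , λ _ _ → z≤n

Adjacent⇒Dist-1 : ∀ {n k} {u v : Subset n} → IsVertex n k v → u ≢ v → Adjacent u v → Dist n k u v 1
Adjacent⇒Dist-1 ∣v∣≡k u≢v u~v = step ∣v∣≡k u~v here , λ where
  zero walk → contradiction (Walk-0⇒≡ walk) u≢v
  (suc m) _ → s≤s z≤n

StronglyResolves-sym : ∀ {n k} {w u v : Subset n} → StronglyResolves n k w u v → StronglyResolves n k w v u
StronglyResolves-sym = swap

∃-neighbour-meeting : ∀ {n k} {u v : Subset n} → 2 ≤ k → 3 * k ≤ suc n →
                      IsVertex n k u → IsVertex n k v → Adjacent u v →
                      ∃ λ w → IsVertex n k w × Adjacent u w × Nonempty (v ∩ w) × w ≢ v
∃-neighbour-meeting {n} {suc (suc j)} {u} {v} (s≤s (s≤s z≤n)) 3k≤1+n ∣u∣≡k ∣v∣≡k u~v =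
  w , ∣w∣≡k , u~w , (x , x∈p∩q⁺ (x∈v , x∈w)) , w≢v
  where
  open ≤-Reasoning
  v≠∅ = ∣p∣≡1+m⇒Nonempty ∣v∣≡k
  x = proj₁ v≠∅
  x∈v : x ∈ v
  x∈v = proj₂ v≠∅
  k-1+∣u∪v∣≤n : suc j + ∣ u ∪ v ∣ ≤ n
  k-1+∣u∪v∣≤n = s≤s⁻¹ (begin
    suc (suc j + ∣ u ∪ v ∣)              ≡⟨ cong (λ s → suc (suc j + s)) (Empty-∩⇒∣p∪q∣≡∣p∣+∣q∣ u~v) ⟩
    suc (suc j + (∣ u ∣ + ∣ v ∣))        ≡⟨ cong (λ s → suc (suc j + s)) (cong₂ _+_ ∣u∣≡k ∣v∣≡k) ⟩
    suc (suc j + (suc (suc j) + suc (suc j)))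
      ≡⟨ cong (λ s → suc (suc j + (suc (suc j) + s))) (+-identityʳ (suc (suc j))) ⟨
    3 * suc (suc j)                      ≤⟨ 3k≤1+n ⟩
    suc n                                ∎)
  avoiding = ∃-avoiding-ofSize (suc j) (u ∪ v) k-1+∣u∪v∣≤n
  t = proj₁ avoiding
  ∣t∣≡k-1 : ∣ t ∣ ≡ suc j
  ∣t∣≡k-1 = proj₁ (proj₂ avoiding)
  t-avoids : ∀ {i} → i ∈ t → i ∉ u ∪ v
  t-avoids = Empty-∩⁻ (proj₂ (proj₂ avoiding))
  w = ⁅ x ⁆ ∪ t
  x∈w : x ∈ w
  x∈w = x∈p∪q⁺ (inj₁ (x∈⁅x⁆ x))
  ∣w∣≡k : ∣ w ∣ ≡ suc (suc j)
  ∣w∣≡k = trans (Empty-∩⇒∣p∪q∣≡∣p∣+∣q∣ (Empty-∩⁺ λ i∈⁅x⁆ i∈t → t-avoids i∈t (x∈p∪q⁺ (inj₂ (x∈p⇒⁅x⁆⊆p x∈v i∈⁅x⁆)))))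
                (cong₂ _+_ (∣⁅x⁆∣≡1 x) ∣t∣≡k-1)
  u~w : Adjacent u w
  u~w = Empty-∩⁺ λ i∈u i∈w → [ (λ i∈⁅x⁆ → Empty-∩⁻ u~v i∈u (x∈p⇒⁅x⁆⊆p x∈v i∈⁅x⁆))
                             , (λ i∈t → t-avoids i∈t (x∈p∪q⁺ (inj₁ i∈u))) ] (x∈p∪q⁻ ⁅ x ⁆ t i∈w)
  -- here k ≥ 2 is needed: t is nonempty, and its points lie in w but not in v
  w≢v : w ≢ v
  w≢v w≡v =
    let (y , y∈t) = ∣p∣≡1+m⇒Nonempty ∣t∣≡k-1
    in t-avoids y∈t (x∈p∪q⁺ (inj₂ (subst (y ∈_) w≡v (x∈p∪q⁺ (inj₂ y∈t)))))

module DiameterTwo {n k : ℕ} (3k≤1+n : 3 * k ≤ suc n) where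
  open DecMembership (_≟ˢ_ {n}) using () renaming (_∈?_ to _∈ₗ?_; _∉?_ to _∉ₗ?_)

  commonNeighbour : ∀ {u v} → IsVertex n k u → IsVertex n k v → Nonempty (u ∩ v) →
                    ∃ λ w → IsVertex n k w × Adjacent u w × Adjacent w v
  commonNeighbour {u} {v} ∣u∣≡k ∣v∣≡k u∩v≠∅ =
    let (w , ∣w∣≡k , w∩[u∪v]=∅) = ∃-avoiding-ofSize k (u ∪ v) k+∣u∪v∣≤n
    in w , ∣w∣≡k , Empty-∩⁺ (λ i∈u i∈w → Empty-∩⁻ w∩[u∪v]=∅ i∈w (x∈p∪q⁺ (inj₁ i∈u)))
                 , Empty-∩⁺ (λ i∈w i∈v → Empty-∩⁻ w∩[u∪v]=∅ i∈w (x∈p∪q⁺ (inj₂ i∈v)))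
    where
    open ≤-Reasoning
    k+∣u∪v∣≤n : k + ∣ u ∪ v ∣ ≤ n
    k+∣u∪v∣≤n = s≤s⁻¹ (begin
      suc (k + ∣ u ∪ v ∣)          ≡⟨ +-suc k ∣ u ∪ v ∣ ⟨
      k + suc ∣ u ∪ v ∣            ≤⟨ +-monoʳ-≤ k (m<m+n ∣ u ∪ v ∣ (Nonempty⇒0<∣p∣ u∩v≠∅)) ⟩
      k + (∣ u ∪ v ∣ + ∣ u ∩ v ∣)  ≡⟨ cong (k +_) (∣p∪q∣+∣p∩q∣≡∣p∣+∣q∣ u v) ⟩
      k + (∣ u ∣ + ∣ v ∣)          ≡⟨ cong (k +_) (cong₂ _+_ ∣u∣≡k ∣v∣≡k) ⟩
      k + (k + k)                  ≡⟨ cong (λ j → k + (k + j)) (+-identityʳ k) ⟨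
      3 * k                        ≤⟨ 3k≤1+n ⟩
      suc n                        ∎)

  Nonempty-∩⇒Dist-2 : ∀ {u v} → IsVertex n k u → IsVertex n k v → u ≢ v → Nonempty (u ∩ v) →
                      Dist n k u v 2
  Nonempty-∩⇒Dist-2 ∣u∣≡k ∣v∣≡k u≢v u∩v≠∅ =
    let (w , ∣w∣≡k , u~w , w~v) = commonNeighbour ∣u∣≡k ∣v∣≡k u∩v≠∅
    in step ∣w∣≡k u~w (step ∣v∣≡k w~v here) , λ _ → Walk-length≥2 u≢v (λ u~v → u~v u∩v≠∅)

  ∃-Dist≤2 : ∀ {u v} → IsVertex n k u → IsVertex n k v → ∃ λ d → Dist n k u v d × d ≤ 2
  ∃-Dist≤2 {u} {v} ∣u∣≡k ∣v∣≡k with u ≟ˢ v | nonempty? (u ∩ v)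
  ... | yes refl | _ = 0 , Dist-refl , z≤n
  ... | no u≢v | yes u∩v≠∅ = 2 , Nonempty-∩⇒Dist-2 ∣u∣≡k ∣v∣≡k u≢v u∩v≠∅ , ≤-refl
  ... | no u≢v | no u∩v=∅ = 1 , Adjacent⇒Dist-1 ∣v∣≡k u≢v u∩v=∅ , s≤s z≤n

  Dist⇒≤2 : ∀ {u v d} → IsVertex n k u → IsVertex n k v → Dist n k u v d → d ≤ 2
  Dist⇒≤2 ∣u∣≡k ∣v∣≡k (_ , shortest) =
    let (d , (walk , _) , d≤2) = ∃-Dist≤2 ∣u∣≡k ∣v∣≡k in ≤-trans (shortest d walk) d≤2

  StronglyResolves-self : ∀ {u v} → IsVertex n k u → IsVertex n k v → StronglyResolves n k u u v
  StronglyResolves-self ∣u∣≡k ∣v∣≡k =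
    let (d , v→u , _) = ∃-Dist≤2 ∣v∣≡k ∣u∣≡k
    in inj₁ (d , d , 0 , v→u , v→u , Dist-refl , sym (+-identityʳ d))

  -- d(v,u) ≥ 2 while d(v,w) ≤ 2 = diameter, so d(v,w) = d(v,u) + d(u,w) forces d(u,w) = 0.
  onGeodesic-from-far⇒≡ : ∀ {u v w a b c} → IsVertex n k v → IsVertex n k w → v ≢ u → ¬ Adjacent v u →
                           Dist n k v w a → Dist n k v u b → Dist n k u w c → a ≡ b + c → u ≡ w
  onGeodesic-from-far⇒≡ {u} {w = w} {c = c} ∣v∣≡k ∣w∣≡k v≢u ¬v~u v→w v→u u→w a≡b+c =
    Walk-0⇒≡ (subst (Walk n k u w) (n≤0⇒n≡0 c≤0) (proj₁ u→w))
    where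
    c≤0 : c ≤ 0
    c≤0 = +-cancelˡ-≤ 2 c 0 (≤-trans (+-monoˡ-≤ c (Walk-length≥2 v≢u ¬v~u (proj₁ v→u)))
                                     (subst (_≤ 2) a≡b+c (Dist⇒≤2 ∣v∣≡k ∣w∣≡k v→w)))

  StronglyResolves-meeting⇒endpoint : ∀ {u v w} → IsVertex n k u → IsVertex n k v → IsVertex n k w →
                                      u ≢ v → Nonempty (u ∩ v) → StronglyResolves n k w u v → u ≡ w ⊎ v ≡ w
  StronglyResolves-meeting⇒endpoint ∣u∣≡k ∣v∣≡k ∣w∣≡k u≢v u∩v≠∅ (inj₁ (_ , _ , _ , v→w , v→u , u→w , a≡b+c)) =
    inj₁ (onGeodesic-from-far⇒≡ ∣v∣≡k ∣w∣≡k (u≢v ∘ sym) (λ v~u → Empty-∩-sym v~u u∩v≠∅) v→w v→u u→w a≡b+c)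
  StronglyResolves-meeting⇒endpoint ∣u∣≡k ∣v∣≡k ∣w∣≡k u≢v u∩v≠∅ (inj₂ (_ , _ , _ , u→w , u→v , v→w , a≡b+c)) =
    inj₂ (onGeodesic-from-far⇒≡ ∣u∣≡k ∣w∣≡k u≢v (λ u~v → u~v u∩v≠∅) u→w u→v v→w a≡b+c)

  neighbour-meeting-resolves : ∀ {u v w} → IsVertex n k u → IsVertex n k v → IsVertex n k w → u ≢ v →
                               Adjacent u v → Adjacent u w → Nonempty (v ∩ w) → w ≢ v → StronglyResolves n k w u v
  neighbour-meeting-resolves {u} {v} {w} ∣u∣≡k ∣v∣≡k ∣w∣≡k u≢v u~v u~w v∩w≠∅ w≢v =
    inj₁ (2 , 1 , 1 , Nonempty-∩⇒Dist-2 ∣v∣≡k ∣w∣≡k (w≢v ∘ sym) v∩w≠∅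
                    , Adjacent⇒Dist-1 ∣u∣≡k (u≢v ∘ sym) (Empty-∩-sym u~v)
                    , Adjacent⇒Dist-1 ∣w∣≡k u≢w u~w , refl)
    where
    u≢w : u ≢ w
    u≢w u≡w = Empty-∩-sym u~v (subst (λ z → Nonempty (v ∩ z)) (sym u≡w) v∩w≠∅)

  ∉-strongResolvingSet⇒Adjacent : ∀ {S u v} → IsStrongResolvingSet n k S → IsVertex n k u → IsVertex n k v →
                                  u ∉ₗ S → v ∉ₗ S → u ≢ v → Adjacent u v
  ∉-strongResolvingSet⇒Adjacent {u = u} {v} (_ , S-vertices , resolves) ∣u∣≡k ∣v∣≡k u∉S v∉S u≢v
    with nonempty? (u ∩ v)
  ... | no u∩v=∅ = u∩v=∅
  ... | yes u∩v≠∅ with find (resolves u v ∣u∣≡k ∣v∣≡k u≢v)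
  ...   | w , w∈S , w-resolves
          with StronglyResolves-meeting⇒endpoint ∣u∣≡k ∣v∣≡k (All.lookup S-vertices w∈S) u≢v u∩v≠∅ w-resolves
  ...     | inj₁ refl = contradiction w∈S u∉S
  ...     | inj₂ refl = contradiction w∈S v∉S

  strongResolvingSet-length≥ : .{{_ : NonZero k}} → ∀ {S} → IsStrongResolvingSet n k S → n C k ∸ n / k ≤ length S
  strongResolvingSet-length≥ {S} S-resolving@(S-unique , S-vertices , _) = m≤n+o⇒m∸n≤o (n C k) (n / k) (begin
    n C k                                 ≡⟨ length-subsetsOfSize n k ⟨
    length (subsetsOfSize n k)            ≡⟨ length≡length+length-filter-∉ _≟ˢ_ S-unique (subsetsOfSize-unique n k)
                                               (All-IsVertex⇒⊆subsetsOfSize S-vertices) ⟩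
    length S + length rest                 ≤⟨ +-monoʳ-≤ (length S) (clique-length≤n/k rest-unique rest-vertices rest-clique) ⟩
    length S + n / k                      ≡⟨ +-comm (length S) (n / k) ⟩
    n / k + length S                      ∎)
    where
    open ≤-Reasoning
    rest = filter (_∉ₗ? S) (subsetsOfSize n k)
    rest-unique : Unique rest
    rest-unique = Unique.filter⁺ (_∉ₗ? S) (subsetsOfSize-unique n k)
    rest-vertices : All (IsVertex n k) rest
    rest-vertices = All-filter⁺ (_∉ₗ? S) (All-subsetsOfSize n k)
    rest-clique : IsClique rest
    rest-clique u∈ v∈ = ∉-strongResolvingSet⇒Adjacent S-resolving
      (All.lookup rest-vertices u∈) (All.lookup rest-vertices v∈)
      (All.lookup (all-filter (_∉ₗ? S) (subsetsOfSize n k)) u∈) (All.lookup (all-filter (_∉ₗ? S) (subsetsOfSize n k)) v∈)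

  module _ (2≤k : 2 ≤ k) {T : List (Subset n)} (T-clique : IsClique T) where

    complement∋ : ∀ {u} → IsVertex n k u → u ∉ₗ T → u ∈ₗ filter (_∉ₗ? T) (subsetsOfSize n k)
    complement∋ ∣u∣≡k u∉T = ∈-filter⁺ (_∉ₗ? T) (∈-subsetsOfSize⁺ _ ∣u∣≡k) u∉T

    cliqueComplement-resolves : ∀ u v → IsVertex n k u → IsVertex n k v → u ≢ v →
                                Any (λ w → StronglyResolves n k w u v) (filter (_∉ₗ? T) (subsetsOfSize n k))
    cliqueComplement-resolves u v ∣u∣≡k ∣v∣≡k u≢v with u ∈ₗ? T | v ∈ₗ? T
    ... | no u∉T | _ = lose (complement∋ ∣u∣≡k u∉T) (StronglyResolves-self ∣u∣≡k ∣v∣≡k)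
    ... | yes _ | no v∉T = lose (complement∋ ∣v∣≡k v∉T) (StronglyResolves-sym (StronglyResolves-self ∣v∣≡k ∣u∣≡k))
    ... | yes u∈T | yes v∈T =
      let u~v = T-clique u∈T v∈T u≢v
          (w , ∣w∣≡k , u~w , v∩w≠∅ , w≢v) = ∃-neighbour-meeting 2≤k 3k≤1+n ∣u∣≡k ∣v∣≡k u~v
      in lose (complement∋ ∣w∣≡k λ w∈T → T-clique v∈T w∈T (w≢v ∘ sym) v∩w≠∅)
              (neighbour-meeting-resolves ∣u∣≡k ∣v∣≡k ∣w∣≡k u≢v u~v u~w v∩w≠∅ w≢v)

  cliqueComplement-strongResolvingSet : 2 ≤ k → ∀ {q} → CliqueOfSize n k q →
    Σ (List (Subset n)) λ S → IsStrongResolvingSet n k S × length S ≡ n C k ∸ q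
  cliqueComplement-strongResolvingSet 2≤k {q} (T , ∣T∣≡q , T-unique , T-vertices , T-clique) =
    S , (Unique.filter⁺ (_∉ₗ? T) (subsetsOfSize-unique n k) , All-filter⁺ (_∉ₗ? T) (All-subsetsOfSize n k)
        , cliqueComplement-resolves 2≤k T-clique) , (begin
      length S                        ≡⟨ m+n∸m≡n (length T) (length S) ⟨
      length T + length S ∸ length T  ≡⟨ cong₂ _∸_ (sym (length≡length+length-filter-∉ _≟ˢ_ T-unique
                                           (subsetsOfSize-unique n k) (All-IsVertex⇒⊆subsetsOfSize T-vertices))) ∣T∣≡q ⟩
      length (subsetsOfSize n k) ∸ q  ≡⟨ cong (_∸ q) (length-subsetsOfSize n k) ⟩
      n C k ∸ q                       ∎)
    where
    open ≡-Reasoning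
    S = filter (_∉ₗ? T) (subsetsOfSize n k)

theorem6 : (n k : ℕ) .{{_ : NonZero k}} → 2 ≤ k → 3 * k ∸ 1 ≤ n →
    StrongMetricDim n k ((n C k) ∸ (n / k))
theorem6 n (suc zero) (s≤s ()) _
theorem6 n k@(suc (suc _)) 2≤k 3k∸1≤n =
  cliqueComplement-strongResolvingSet 2≤k (∃-clique-≤ (n / k) (m/n*n≤m n k)) ,
  λ _ → strongResolvingSet-length≥
  where open DiameterTwo {n} {k} (s≤s 3k∸1≤n)
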